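{- (Soundness of LP-TM.) Let $\Phi$ be a logic program and $A$ an atomic formula. If $\Phi\vdash\{A\}\to^*\emptyset$, then there exists a proof term $e$ with $e:\forall\underline{x}.\ \Rightarrow A$ derivable given axioms $\Phi$.
   Context: First-order terms; atomic formulas $P(t_1,\dots,t_n)$; Horn formulas $[\forall \underline{x}].\ A_1,\dots,A_n \Rightarrow A$ ($n\ge0$; for $n=0$ written $\Rightarrow A$), $\forall\underline{x}$ quantifying all free term variables. Proof terms $p,e ::= \kappa \mid a \mid \lambda a.e \mid e\ e'$. A logic program $\Phi$ is a list of closed Horn formulas labelled by distinct proof-term constants. Typing given $\Phi$: (axiom) $\kappa:\forall\underline{x}.F$ if $(\kappa:\forall\underline{x}.F)\in\Phi$; (gen) $e:F\Rightarrow e:\forall\underline{x}.F$; (inst) $e:\forall\underline{x}.F\Rightarrow e:[\underline{t}/\underline{x}]F$; (cut) from $e_1:\underline{A}\Rightarrow D$ and $e_2:\underline{B},D\Rightarrow C$ infer $\lambda\underline{a}.\lambda\underline{b}.(e_2\ \underline{b})(e_1\ \underline{a}):\underline{A},\underline{B}\Rightarrow C$ with fresh proof-variable lists $\underline{a},\underline{b}$. Term-matching (LP-TM) reduction on multisets of atomic formulas: $\Phi\vdash\{A_1,\dots,A_i,\dots,A_n\}\to\{A_1,\dots,\sigma B_1,\dots,\sigma B_m,\dots,A_n\}$ whenever $\kappa:\forall\underline{x}.B_1,\dots,B_m\Rightarrow C\in\Phi$ (variables renamed apart) and $\sigma$ is a matcher with $\sigma C\equiv A_i$. $\to^*$ is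 the reflexive–transitive closure. -}

module Defs where

open import Data.Nat using (ℕ)
open import Data.List using (List; []; _∷_; _++_; map; length)
open import Data.List.Membership.Propositional using (_∈_; _∉_)
open import Data.List.Relation.Unary.Unique.Propositional using (Unique)
open import Data.Product using (_×_; _,_; proj₁)
open import Relation.Binary.PropositionalEquality using (_≡_)
open import Relation.Binary.Construct.Closure.ReflexiveTransitive using (Star)

data Term : Set where
  var : ℕ → Term
  fn  : ℕ → List Term → Term

record Atom : Set where
  constructor _⟨_⟩
  field
    pred : ℕ
    args : List Term

Subst : Set
Subst = ℕ → Term

mutual
  substT : Subst → Term → Term
  substT σ (var x)     = σ x
  substT σ (fn f ts)   = fn f (substTs σ ts)

  substTs : Subst → List Term → List Term
  substTs σ []         = []
  substTs σ (t ∷ ts)   = substT σ t ∷ substTs σ ts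

substA : Subst → Atom → Atom
substA σ (P ⟨ ts ⟩) = P ⟨ substTs σ ts ⟩

-- Horn formulas  A₁,…,Aₙ ⇒ A   (the universal closure ∀x̲ is a separate
-- judgement form below, quantifying all free term variables).

record Horn : Set where
  constructor _⇒_
  field
    prem : List Atom
    head : Atom

substH : Subst → Horn → Horn
substH σ (As ⇒ A) = map (substA σ) As ⇒ substA σ A

data PTerm : Set where
  con : ℕ → PTerm
  pv  : ℕ → PTerm
  lam : ℕ → PTerm → PTerm
  app : PTerm → PTerm → PTerm

lams : List ℕ → PTerm → PTerm
lams []       e = e
lams (a ∷ as) e = lam a (lams as e)

apps : PTerm → List ℕ → PTerm
apps e []       = e
apps e (a ∷ as) = apps (app e (pv a)) as

pvars : PTerm → List ℕ
pvars (con _)   = []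
pvars (pv a)    = a ∷ []
pvars (lam a e) = a ∷ pvars e
pvars (app e f) = pvars e ++ pvars f

-- Logic programs: lists of closed Horn formulas ∀x̲.F labelled by
-- proof-term constants (distinctness of labels is a separate hypothesis).

Program : Set
Program = List (ℕ × Horn)

Labels : Program → List ℕ
Labels Φ = map proj₁ Φ

-- Typing given Φ.
--   Φ ⊢ e ∶ F      : e has the (open) Horn formula F
--   Φ ⊢ e ∶∀ F     : e has the closed formula ∀x̲.F  (x̲ = all free vars of F)

mutual
  data _⊢_∶_ (Φ : Program) : PTerm → Horn → Set where
    inst : ∀ {e F} (σ : Subst) → Φ ⊢ e ∶∀ F → Φ ⊢ e ∶ substH σ F
    cut  : ∀ {e₁ e₂ As Bs D C} (as bs : List ℕ) →
           length as ≡ length As →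
           length bs ≡ length Bs →
           Unique (as ++ bs) →
           (∀ {a} → a ∈ as ++ bs → a ∉ pvars e₁ ++ pvars e₂) →
           Φ ⊢ e₁ ∶ (As ⇒ D) →
           Φ ⊢ e₂ ∶ ((Bs ++ D ∷ []) ⇒ C) →
           Φ ⊢ lams as (lams bs (app (apps e₂ bs) (apps e₁ as))) ∶ ((As ++ Bs) ⇒ C)

  data _⊢_∶∀_ (Φ : Program) : PTerm → Horn → Set where
    axiom : ∀ {κ F} → (κ , F) ∈ Φ → Φ ⊢ con κ ∶∀ F
    gen   : ∀ {e F} → Φ ⊢ e ∶ F → Φ ⊢ e ∶∀ F

-- LP-TM (term-matching) reduction on multisets of atoms, represented as
-- lists; the selected atom may be at any position.

data _⊢_⟶_ (Φ : Program) : List Atom → List Atom → Set where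
  step : ∀ {κ Bs C} (L R : List Atom) (σ : Subst) →
         (κ , (Bs ⇒ C)) ∈ Φ →
         Φ ⊢ (L ++ substA σ C ∷ R) ⟶ (L ++ map (substA σ) Bs ++ R)

_⊢_⟶*_ : Program → List Atom → List Atom → Set
Φ ⊢ xs ⟶* ys = Star (Φ ⊢_⟶_) xs ys

-- A goal list that reduces to ∅ consists of atoms with closed proofs: read the
-- reduction backwards.  A step replaces σC by σB₁, …, σBₘ using a clause
-- κ : ∀x̲. B₁,…,Bₘ ⇒ C; instantiating κ with σ gives σB₁,…,σBₘ ⇒ σC, and cutting
-- the closed proofs of the σBᵢ into it, last premise first, leaves a proof of ⇒ σC.
module Submission where

open import Defs
open import Data.List using (List; []; _∷_; _++_; map; length; applyUpTo)
open import Data.List.Relation.Unary.Unique.Propositional using (Unique)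
open import Data.Product using (∃)

open import Data.Nat using (ℕ; suc; _+_; s≤s)
open import Data.Nat.Properties using (+-cancelˡ-≡; suc-injective; <⇒≢; n≮n; ≤-trans; m≤m+n)
open import Data.List.Properties using (length-applyUpTo)
open import Data.List.Extrema.Nat using (max; xs≤max)
open import Data.List.Membership.Propositional using (_∈_; _∉_)
open import Data.List.Membership.Propositional.Properties using (∈-applyUpTo⁻)
open import Data.List.Relation.Unary.All as All using (All; []; _∷_)
open import Data.List.Relation.Unary.All.Properties using (++⁺; ++⁻)
open import Data.List.Relation.Unary.Unique.Propositional.Properties using (applyUpTo⁺₁)
open import Data.List.Reverse using (Reverse; []; _∶_∶ʳ_; reverseView)
open import Data.Product using (Σ; _,_; _×_)
open import Relation.Binary.PropositionalEquality using (_≡_; refl)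
open import Relation.Binary.Construct.Closure.ReflexiveTransitive using (ε; _◅_)

∃-fresh-names : (X : List ℕ) (n : ℕ) →
                Σ (List ℕ) λ as → length as ≡ n × Unique as × (∀ {a} → a ∈ as → a ∉ X)
∃-fresh-names X n = applyUpTo name n , length-applyUpTo name n , distinct , fresh
  where
  name : ℕ → ℕ
  name i = suc (max 0 X + i)

  distinct : Unique (applyUpTo name n)
  distinct = applyUpTo⁺₁ name n λ i<j _ eq → <⇒≢ i<j (+-cancelˡ-≡ (max 0 X) _ _ (suc-injective eq))

  fresh : ∀ {a} → a ∈ applyUpTo name n → a ∉ X
  fresh a∈ a∈X with ∈-applyUpTo⁻ name a∈
  ... | i , _ , refl =
    n≮n (max 0 X) (≤-trans (s≤s (m≤m+n (max 0 X) i)) (All.lookup (xs≤max 0 X) a∈X))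

module _ {Φ : Program} where

  Provable : Atom → Set
  Provable A = ∃ λ e → Φ ⊢ e ∶ ([] ⇒ A)

  cut-provable-last : ∀ {e Bs D C} → Provable D → Φ ⊢ e ∶ ((Bs ++ D ∷ []) ⇒ C) →
                      ∃ λ e′ → Φ ⊢ e′ ∶ (Bs ⇒ C)
  cut-provable-last {e} {Bs} (d , ⊢d) ⊢e with ∃-fresh-names (pvars d ++ pvars e) (length Bs)
  ... | bs , |bs| , distinct , fresh = _ , cut [] bs refl |bs| distinct fresh ⊢d ⊢e

  discharge-premises : ∀ {Ps e C} → Reverse Ps → Φ ⊢ e ∶ (Ps ⇒ C) →
                       All Provable Ps → Provable C
  discharge-premises []              ⊢e []  = _ , ⊢e
  discharge-premises (Bs ∶ r ∶ʳ D) ⊢e ⊢Ps with ++⁻ Bs ⊢Ps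
  ... | ⊢Bs , ⊢D ∷ [] with cut-provable-last ⊢D ⊢e
  ...   | _ , ⊢e′ = discharge-premises r ⊢e′ ⊢Bs

  ⟶-reflects-provable : ∀ {Gs Hs} → Φ ⊢ Gs ⟶ Hs → All Provable Hs → All Provable Gs
  ⟶-reflects-provable (step {Bs = Bs} L R σ κ∈Φ) ⊢Hs with ++⁻ L ⊢Hs
  ... | ⊢L , ⊢σBsR with ++⁻ (map (substA σ) Bs) ⊢σBsR
  ...   | ⊢σBs , ⊢R =
    ++⁺ ⊢L (discharge-premises (reverseView _) (inst σ (axiom κ∈Φ)) ⊢σBs ∷ ⊢R)

  ⟶*-empty-provable : ∀ {Gs} → Φ ⊢ Gs ⟶* [] → All Provable Gs
  ⟶*-empty-provable ε          = []
  ⟶*-empty-provable (s ◅ rest) = ⟶-reflects-provable s (⟶*-empty-provable rest)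

-- Soundness does not need the labels of Φ to be distinct.
theorem8 : (Φ : Program) → Unique (Labels Φ) → (A : Atom) →
           Φ ⊢ (A ∷ []) ⟶* [] →
           ∃ λ e → Φ ⊢ e ∶∀ ([] ⇒ A)
theorem8 Φ _ A A⟶*∅ with ⟶*-empty-provable A⟶*∅
... | (e , ⊢e) ∷ [] = e , gen ⊢e
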